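{- Let $P$ be a fixed finite poset with exactly $m$ antichains (counting the empty antichain). Then, as $n\to\infty$, the Boolean lattice $\mathcal{P}(n)$ contains $(1+o(1))m^n$ copies of $P$.
   Context: $\mathcal{P}(n)$ denotes the power set of $[n]=\{1,\dots,n\}$ ordered by inclusion. A poset homomorphism from $(P,\le_P)$ to $(Q,\le_Q)$ is a map $\phi:P\to Q$ such that $x\le_P y$ implies $\phi(x)\le_Q\phi(y)$. A copy of $P$ in $\mathcal{P}(n)$ is an injective poset homomorphism $P\to\mathcal{P}(n)$. -}

module Defs where

open import Level using (0ℓ)
open import Data.Nat using (ℕ; zero; suc)
open import Data.Bool using (Bool; true; false)
open import Data.Bool.Properties using () renaming (_≟_ to _≟ᵇ_)
open import Data.List using (List; []; _∷_; length; filter; concatMap; map)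
open import Data.Vec using (Vec; []; _∷_; lookup)
open import Data.Vec.Properties using (≡-dec)
open import Data.Fin using (Fin)
open import Data.Fin.Properties using (all?)
open import Data.Fin.Subset using (Subset; _∈_; _⊆_)
open import Data.Fin.Subset.Properties using (_∈?_; _⊆?_)
open import Relation.Binary using (Rel; IsDecPartialOrder)
open import Relation.Binary.PropositionalEquality using (_≡_)
open import Relation.Nullary using (Dec)
open import Relation.Nullary.Decidable using (_→-dec_; _×-dec_)
open import Data.Product using (_×_)
open import Data.Fin.Properties using () renaming (_≟_ to _≟ᶠ_)

allVecs : {A : Set} → List A → (k : ℕ) → List (Vec A k)
allVecs xs zero = [] ∷ []
allVecs xs (suc k) = concatMap (λ x → map (x ∷_) (allVecs xs k)) xs

allSubsets : (n : ℕ) → List (Subset n)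
allSubsets n = allVecs (true ∷ false ∷ []) n

module _ {p : ℕ} (_≤P_ : Rel (Fin p) 0ℓ) (isDPO : IsDecPartialOrder _≡_ _≤P_) where
  open IsDecPartialOrder isDPO using (_≤?_)

  IsAntichain : Subset p → Set
  IsAntichain S = ∀ i j → i ∈ S → j ∈ S → i ≤P j → i ≡ j

  isAntichain? : (S : Subset p) → Dec (IsAntichain S)
  isAntichain? S = all? λ i → all? λ j →
    (i ∈? S) →-dec (j ∈? S) →-dec (i ≤? j) →-dec (i ≟ᶠ j)

  numAntichains : ℕ
  numAntichains = length (filter isAntichain? (allSubsets p))

  IsCopy : {n : ℕ} → (Fin p → Subset n) → Set
  IsCopy φ = (∀ i j → i ≤P j → φ i ⊆ φ j) × (∀ i j → φ i ≡ φ j → i ≡ j)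

  isCopy? : {n : ℕ} (φ : Fin p → Subset n) → Dec (IsCopy φ)
  isCopy? φ = (all? λ i → all? λ j → (i ≤? j) →-dec (φ i ⊆? φ j))
         ×-dec (all? λ i → all? λ j → ≡-dec _≟ᵇ_ (φ i) (φ j) →-dec (i ≟ᶠ j))

  -- number of copies of P in 𝒫(n): maps Fin p → Subset n are enumerated
  -- (each exactly once) as vectors of p subsets
  numCopies : ℕ → ℕ
  numCopies n = length (filter (λ v → isCopy? (lookup v)) (allVecs (allSubsets n) p))

module Submission where

-- A map φ : P → 𝒫(n), viewed as a p × n Boolean matrix, is a homomorphism
-- iff each of its n columns is an up-set of P.  Up-sets correspond to
-- antichains (U ↦ minimal elements of U, A ↦ up-closure of A), so there are
-- m up-sets and m^n homomorphisms; in particular copies ≤ m^n.  A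
-- homomorphism that is not a copy identifies two points i ≠ j, so all its
-- columns fail to separate i and j; a principal up-set does separate them,
-- so there are at most m - 1 such columns.  Hence
--     m^n ≤ copies + p² (m - 1)^n,
-- and a Bernoulli-type estimate gives C (m - 1)^n ≤ m^n once n > C (m - 1).

open import Defs
open import Level using (0ℓ)
open import Data.Nat using (ℕ; zero; suc; pred; _+_; _*_; _^_; _≤_; _<_; z≤n; s≤s)
open import Data.Nat.Properties
open import Data.Nat.Induction using (<-wellFounded)
open import Data.Nat.Tactic.RingSolver using (solve-∀)
open import Induction.WellFounded using (Acc; acc)
open import Data.Bool using (Bool; true; false)
open import Data.Bool.Properties using () renaming (_≟_ to _≟ᵇ_)
open import Data.Fin using (Fin)
open import Data.Fin.Properties using (all?; any?) renaming (_≟_ to _≟ᶠ_)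
open import Data.Fin.Subset using (Subset; _∈_; _⊆_; ∣_∣)
open import Data.Fin.Subset.Properties using (_∈?_; ⊆-antisym; p⊂q⇒∣p∣<∣q∣)
open import Data.List using (List; []; _∷_; length; filter; map; concatMap; _++_; allFin; cartesianProductWith; cartesianProduct)
open import Data.List.Properties using (length-++; length-map; length-tabulate; filter-notAll)
open import Data.List.Membership.Propositional using (lose) renaming (_∈_ to _∈ₗ_)
open import Data.List.Membership.Propositional.Properties using (∈-∃++; ∈-++⁻; ∈-++⁺ˡ; ∈-++⁺ʳ; ∈-map⁺; ∈-filter⁺; ∈-filter⁻; ∈-concatMap⁺; ∈-cartesianProductWith⁺; ∈-cartesianProductWith⁻; ∈-cartesianProduct⁺; ∈-allFin)
open import Data.List.Relation.Unary.Any using (here; there)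
import Data.List.Relation.Unary.All as All
open import Data.List.Relation.Unary.AllPairs using ([]; _∷_)
open import Data.List.Relation.Unary.Unique.Propositional using (Unique)
import Data.List.Relation.Unary.Unique.Propositional.Properties as Unique
open import Data.Vec using (Vec; []; _∷_; lookup; tabulate)
open import Data.Vec.Properties using (lookup∘tabulate; tabulate∘lookup; tabulate-cong; []=⇒lookup; lookup⇒[]=; ∷-injective; ≡-dec)
open import Data.Product using (_×_; _,_; proj₁; proj₂; ∃; ∃-syntax)
open import Data.Sum using (inj₁; inj₂)
open import Data.Empty using (⊥-elim)
open import Function using (_∘_; id)
open import Relation.Binary using (Rel; IsDecPartialOrder)
open import Relation.Binary.PropositionalEquality using (_≡_; _≢_; refl; sym; trans; cong; cong₂; subst; module ≡-Reasoning)
open import Relation.Nullary using (¬_; Dec; yes; no; does; ¬?)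
open import Relation.Nullary.Decidable using (_→-dec_; _×-dec_; dec-true; decidable-stable)
open import Relation.Unary using (Pred; Decidable)

private variable
  A B C : Set
  k : ℕ

injective-length≤ : (f : A → B) {xs : List A} {ys : List B} → Unique xs →
  (∀ {x y} → x ∈ₗ xs → y ∈ₗ xs → f x ≡ f y → x ≡ y) →
  (∀ {x} → x ∈ₗ xs → f x ∈ₗ ys) → length xs ≤ length ys
injective-length≤ f {[]} _ _ _ = z≤n
injective-length≤ f {x ∷ xs} (x∉xs ∷ unique) injective into
  with ys₁ , ys₂ , refl ← ∈-∃++ (into (here refl)) = begin
    suc (length xs)                ≤⟨ s≤s (injective-length≤ f unique injective′ into′) ⟩
    suc (length (ys₁ ++ ys₂))      ≡⟨ cong suc (length-++ ys₁) ⟩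
    suc (length ys₁ + length ys₂)  ≡⟨ sym (+-suc (length ys₁) (length ys₂)) ⟩
    length ys₁ + length (f x ∷ ys₂) ≡⟨ sym (length-++ ys₁) ⟩
    length (ys₁ ++ f x ∷ ys₂)      ∎
  where
  open ≤-Reasoning
  injective′ : ∀ {y z} → y ∈ₗ xs → z ∈ₗ xs → f y ≡ f z → y ≡ z
  injective′ y∈ z∈ = injective (there y∈) (there z∈)
  into′ : ∀ {y} → y ∈ₗ xs → f y ∈ₗ ys₁ ++ ys₂
  into′ {y} y∈ with ∈-++⁻ ys₁ (into (there y∈))
  ... | inj₁ fy∈ys₁ = ∈-++⁺ˡ fy∈ys₁
  ... | inj₂ (here fy≡fx) = ⊥-elim (All.lookup x∉xs y∈ (sym (injective (there y∈) (here refl) fy≡fx)))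
  ... | inj₂ (there fy∈ys₂) = ∈-++⁺ʳ ys₁ fy∈ys₂

length-concatMap≤ : (f : A → List B) (b : ℕ) (xs : List A) →
  (∀ {x} → x ∈ₗ xs → length (f x) ≤ b) → length (concatMap f xs) ≤ length xs * b
length-concatMap≤ f b [] _ = z≤n
length-concatMap≤ f b (x ∷ xs) bounded = begin
  length (f x ++ concatMap f xs)        ≡⟨ length-++ (f x) ⟩
  length (f x) + length (concatMap f xs) ≤⟨ +-mono-≤ (bounded (here refl)) (length-concatMap≤ f b xs (bounded ∘ there)) ⟩
  b + length xs * b                      ∎
  where open ≤-Reasoning

length-cartesianProductWith : (f : A → B → C) (xs : List A) (ys : List B) →
  length (cartesianProductWith f xs ys) ≡ length xs * length ys
length-cartesianProductWith f [] ys = refl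
length-cartesianProductWith f (x ∷ xs) ys = begin
  length (map (f x) ys ++ cartesianProductWith f xs ys)          ≡⟨ length-++ (map (f x) ys) ⟩
  length (map (f x) ys) + length (cartesianProductWith f xs ys)  ≡⟨ cong₂ _+_ (length-map (f x) ys) (length-cartesianProductWith f xs ys) ⟩
  length ys + length xs * length ys                              ∎
  where open ≡-Reasoning

allVecs-suc : (xs : List A) (k : ℕ) → allVecs xs (suc k) ≡ cartesianProductWith _∷_ xs (allVecs xs k)
allVecs-suc xs k = go xs
  where
  go : ∀ ys → concatMap (λ y → map (y ∷_) (allVecs xs k)) ys ≡ cartesianProductWith _∷_ ys (allVecs xs k)
  go [] = refl
  go (y ∷ ys) = cong (map (y ∷_) (allVecs xs k) ++_) (go ys)

length-allVecs : (xs : List A) (k : ℕ) → length (allVecs xs k) ≡ length xs ^ k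
length-allVecs xs zero = refl
length-allVecs xs (suc k) = begin
  length (allVecs xs (suc k))                          ≡⟨ cong length (allVecs-suc xs k) ⟩
  length (cartesianProductWith _∷_ xs (allVecs xs k))  ≡⟨ length-cartesianProductWith _∷_ xs (allVecs xs k) ⟩
  length xs * length (allVecs xs k)                    ≡⟨ cong (length xs *_) (length-allVecs xs k) ⟩
  length xs * length xs ^ k                            ∎
  where open ≡-Reasoning

allVecs-unique : (xs : List A) (k : ℕ) → Unique xs → Unique (allVecs xs k)
allVecs-unique xs zero _ = All.[] ∷ []
allVecs-unique xs (suc k) unique = subst Unique (sym (allVecs-suc xs k))
  (Unique.cartesianProductWith⁺ _∷_ ∷-injective unique (allVecs-unique xs k unique))

∈-allVecs⁺ : {xs : List A} (v : Vec A k) → (∀ i → lookup v i ∈ₗ xs) → v ∈ₗ allVecs xs k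
∈-allVecs⁺ [] _ = here refl
∈-allVecs⁺ {xs = xs} (x ∷ v) entries = subst (x ∷ v ∈ₗ_) (sym (allVecs-suc xs _))
  (∈-cartesianProductWith⁺ _∷_ (entries Fin.zero) (∈-allVecs⁺ v (entries ∘ Fin.suc)))

∈-allVecs⁻ : {xs : List A} (v : Vec A k) → v ∈ₗ allVecs xs k → ∀ i → lookup v i ∈ₗ xs
∈-allVecs⁻ {xs = xs} (x ∷ v) v∈ i
  with _ , _ , x∈ , v∈′ , refl ← ∈-cartesianProductWith⁻ _∷_ xs (allVecs xs _) (subst (x ∷ v ∈ₗ_) (allVecs-suc xs _) v∈)
  with i
... | Fin.zero = x∈
... | Fin.suc i′ = ∈-allVecs⁻ v v∈′ i′

allSubsets-complete : ∀ {n} (S : Subset n) → S ∈ₗ allSubsets n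
allSubsets-complete S = ∈-allVecs⁺ S (λ i → bool∈ (lookup S i))
  where
  bool∈ : (b : Bool) → b ∈ₗ true ∷ false ∷ []
  bool∈ true = here refl
  bool∈ false = there (here refl)

allSubsets-unique : ∀ n → Unique (allSubsets n)
allSubsets-unique n = allVecs-unique _ n (((λ ()) All.∷ All.[]) ∷ All.[] ∷ [])

-- Bernoulli's inequality (1 + 1/a)^n ≥ 1 + n/a with denominators cleared.
bernoulli : ∀ a n → a ^ n * (a + n) ≤ a * suc a ^ n
bernoulli a zero = ≤-reflexive (base a)
  where
  base : ∀ a → 1 * (a + 0) ≡ a * 1
  base = solve-∀
bernoulli a (suc n) = begin
  a * a ^ n * (a + suc n)                ≡⟨ expand a (a ^ n) n ⟩
  a * (a ^ n * (a + n)) + a * a ^ n      ≤⟨ +-mono-≤ (*-monoʳ-≤ a (bernoulli a n)) (*-monoʳ-≤ a (^-monoˡ-≤ n (n≤1+n a))) ⟩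
  a * (a * suc a ^ n) + a * suc a ^ n    ≡⟨ collect a (suc a ^ n) ⟩
  a * (suc a * suc a ^ n)                ∎
  where
  open ≤-Reasoning
  expand : ∀ a x n → a * x * (a + suc n) ≡ a * (x * (a + n)) + a * x
  expand = solve-∀
  collect : ∀ a y → a * (a * y) + a * y ≡ a * (suc a * y)
  collect = solve-∀

domination : ∀ C m n → C * pred m < n → C * pred m ^ n ≤ m ^ n
domination C zero (suc n) _ = ≤-reflexive (*-zeroʳ C)
domination C (suc zero) (suc n) _ = ≤-trans (≤-reflexive (*-zeroʳ C)) z≤n
domination C (suc (suc b)) n C*a<n = *-cancelˡ-≤ a (begin
  a * (C * a ^ n)      ≡⟨ trans (sym (*-assoc a C (a ^ n))) (cong (_* a ^ n) (*-comm a C)) ⟩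
  C * a * a ^ n        ≤⟨ *-monoˡ-≤ (a ^ n) (<⇒≤ C*a<n) ⟩
  n * a ^ n            ≤⟨ *-monoˡ-≤ (a ^ n) (m≤n+m n a) ⟩
  (a + n) * a ^ n      ≡⟨ *-comm (a + n) (a ^ n) ⟩
  a ^ n * (a + n)      ≤⟨ bernoulli a n ⟩
  a * suc a ^ n        ∎)
  where
  open ≤-Reasoning
  a = suc b

module _ {P : Pred (Fin k) 0ℓ} (P? : Decidable P) where

  select : Subset k
  select = tabulate (does ∘ P?)

  ∈-select⁺ : ∀ {i} → P i → i ∈ select
  ∈-select⁺ {i} Pi = lookup⇒[]= i select (trans (lookup∘tabulate (does ∘ P?) i) (dec-true (P? i) Pi))

  ∈-select⁻ : ∀ {i} → i ∈ select → P i
  ∈-select⁻ {i} i∈ = witness (P? i) (trans (sym (lookup∘tabulate (does ∘ P?) i)) ([]=⇒lookup i∈))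
    where
    witness : ∀ {Q : Set} (Q? : Dec Q) → does Q? ≡ true → Q
    witness (yes q) _ = q
    witness (no _) ()

lookup-extensional : {v w : Vec A k} → (∀ i → lookup v i ≡ lookup w i) → v ≡ w
lookup-extensional {v = v} {w} same = trans (sym (tabulate∘lookup v)) (trans (tabulate-cong same) (tabulate∘lookup w))

columns : ∀ {p n} → Vec (Vec A n) p → Vec (Vec A p) n
columns v = tabulate λ x → tabulate λ i → lookup (lookup v i) x

lookup-columns : ∀ {p n} (v : Vec (Vec A n) p) x i → lookup (lookup (columns v) x) i ≡ lookup (lookup v i) x
lookup-columns v x i = begin
  lookup (lookup (columns v) x) i                          ≡⟨ cong (λ row → lookup row i) (lookup∘tabulate _ x) ⟩
  lookup (tabulate λ j → lookup (lookup v j) x) i          ≡⟨ lookup∘tabulate _ i ⟩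
  lookup (lookup v i) x                                    ∎
  where open ≡-Reasoning

columns-involutive : ∀ {p n} (v : Vec (Vec A n) p) → columns (columns v) ≡ v
columns-involutive v = lookup-extensional λ i → lookup-extensional λ x →
  trans (lookup-columns (columns v) i x) (lookup-columns v x i)

columns-injective : ∀ {p n} {v w : Vec (Vec A n) p} → columns v ≡ columns w → v ≡ w
columns-injective {v = v} {w} same =
  trans (sym (columns-involutive v)) (trans (cong columns same) (columns-involutive w))

∈-columns⁺ : ∀ {p n} (v : Vec (Subset n) p) {x i} → x ∈ lookup v i → i ∈ lookup (columns v) x
∈-columns⁺ v {x} {i} x∈ = lookup⇒[]= i _ (trans (lookup-columns v x i) ([]=⇒lookup x∈))

∈-columns⁻ : ∀ {p n} (v : Vec (Subset n) p) {x i} → i ∈ lookup (columns v) x → x ∈ lookup v i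
∈-columns⁻ v {x} {i} i∈ = lookup⇒[]= x _ (trans (sym (lookup-columns v x i)) ([]=⇒lookup i∈))

module FinitePoset {p : ℕ} (_≤P_ : Rel (Fin p) 0ℓ) (isDPO : IsDecPartialOrder _≡_ _≤P_) where
  open IsDecPartialOrder isDPO using () renaming (_≤?_ to _≤P?_; refl to ≤P-refl; trans to ≤P-trans; antisym to ≤P-antisym)

  IsUpset : Subset p → Set
  IsUpset U = ∀ i j → i ∈ U → i ≤P j → j ∈ U

  isUpset? : (U : Subset p) → Dec (IsUpset U)
  isUpset? U = all? λ i → all? λ j → (i ∈? U) →-dec (i ≤P? j) →-dec (j ∈? U)

  upsets : List (Subset p)
  upsets = filter isUpset? (allSubsets p)

  antichains : List (Subset p)
  antichains = filter (isAntichain? _≤P_ isDPO) (allSubsets p)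

  ∈-upsets : ∀ {U} → IsUpset U → U ∈ₗ upsets
  ∈-upsets = ∈-filter⁺ isUpset? (allSubsets-complete _)

  upset-of : ∀ {U} → U ∈ₗ upsets → IsUpset U
  upset-of U∈ = proj₂ (∈-filter⁻ isUpset? {xs = allSubsets p} U∈)

  antichain-of : ∀ {A} → A ∈ₗ antichains → IsAntichain _≤P_ isDPO A
  antichain-of A∈ = proj₂ (∈-filter⁻ (isAntichain? _≤P_ isDPO) {xs = allSubsets p} A∈)

  Above : Subset p → Fin p → Set
  Above A j = ∃ λ i → i ∈ A × i ≤P j

  above? : ∀ A j → Dec (Above A j)
  above? A j = any? λ i → (i ∈? A) ×-dec (i ≤P? j)

  ↑_ : Subset p → Subset p
  ↑ A = select (above? A)

  ↑-upset : ∀ A → IsUpset (↑ A)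
  ↑-upset A i j i∈ i≤j with k , k∈ , k≤i ← ∈-select⁻ (above? A) i∈ = ∈-select⁺ (above? A) (k , k∈ , ≤P-trans k≤i i≤j)

  ↑-reflects-⊆ : ∀ {A B} → IsAntichain _≤P_ isDPO A → ↑ A ≡ ↑ B → A ⊆ B
  ↑-reflects-⊆ {A} {B} antichain same {a} a∈A
    with b , b∈B , b≤a ← ∈-select⁻ (above? B) (subst (a ∈_) same (∈-select⁺ (above? A) (a , a∈A , ≤P-refl)))
    with a′ , a′∈A , a′≤b ← ∈-select⁻ (above? A) (subst (b ∈_) (sym same) (∈-select⁺ (above? B) (b , b∈B , ≤P-refl)))
    with refl ← antichain a′ a a′∈A a∈A (≤P-trans a′≤b b≤a)
    = subst (_∈ B) (≤P-antisym b≤a a′≤b) b∈B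

  ↑-injective : ∀ {A B} → IsAntichain _≤P_ isDPO A → IsAntichain _≤P_ isDPO B → ↑ A ≡ ↑ B → A ≡ B
  ↑-injective antichainA antichainB same =
    ⊆-antisym (↑-reflects-⊆ antichainA same) (↑-reflects-⊆ antichainB (sym same))

  Minimal : Subset p → Fin p → Set
  Minimal U i = i ∈ U × (∀ j → j ∈ U → j ≤P i → j ≡ i)

  minimal? : ∀ U i → Dec (Minimal U i)
  minimal? U i = (i ∈? U) ×-dec all? λ j → (j ∈? U) →-dec (j ≤P? i) →-dec (j ≟ᶠ i)

  minimals : Subset p → Subset p
  minimals U = select (minimal? U)

  minimals-antichain : ∀ U → IsAntichain _≤P_ isDPO (minimals U)
  minimals-antichain U i j i∈ j∈ i≤j = proj₂ (∈-select⁻ (minimal? U) j∈) i (proj₁ (∈-select⁻ (minimal? U) i∈)) i≤j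

  -- Below every element of U lies a minimal element of U; by well-founded
  -- induction on the size of U ∩ ↓j.
  belowIn? : ∀ U j k → Dec (k ∈ U × k ≤P j)
  belowIn? U j k = (k ∈? U) ×-dec (k ≤P? j)

  below : Subset p → Fin p → Subset p
  below U j = select (belowIn? U j)

  below-shrinks : ∀ {U j k} → j ∈ U → k ≤P j → k ≢ j → ∣ below U k ∣ < ∣ below U j ∣
  below-shrinks {U} {j} {k} j∈ k≤j k≢j = p⊂q⇒∣p∣<∣q∣ (shrink , j , ∈-select⁺ (belowIn? U j) (j∈ , ≤P-refl) , j∉)
    where
    shrink : below U k ⊆ below U j
    shrink l∈ with l∈U , l≤k ← ∈-select⁻ (belowIn? U k) l∈ = ∈-select⁺ (belowIn? U j) (l∈U , ≤P-trans l≤k k≤j)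
    j∉ : ¬ j ∈ below U k
    j∉ j∈′ = k≢j (≤P-antisym k≤j (proj₂ (∈-select⁻ (belowIn? U k) j∈′)))

  minimal-below : ∀ U j → j ∈ U → ∃ λ i → Minimal U i × i ≤P j
  minimal-below U j = go j (<-wellFounded ∣ below U j ∣)
    where
    go : ∀ j → Acc _<_ ∣ below U j ∣ → j ∈ U → ∃ λ i → Minimal U i × i ≤P j
    go j (acc smaller) j∈ with any? (λ k → (k ∈? U) ×-dec (k ≤P? j) ×-dec ¬? (k ≟ᶠ j))
    ... | no nothingBelow =
      j , (j∈ , λ k k∈ k≤j → decidable-stable (k ≟ᶠ j) λ k≢j → nothingBelow (k , k∈ , k≤j , k≢j)) , ≤P-refl
    ... | yes (k , k∈ , k≤j , k≢j) with i , minimal , i≤k ← go k (smaller (below-shrinks j∈ k≤j k≢j)) k∈ =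
      i , minimal , ≤P-trans i≤k k≤j

  ↑-minimals : ∀ U → IsUpset U → ↑ (minimals U) ≡ U
  ↑-minimals U upset = ⊆-antisym closure⊆ ⊆closure
    where
    closure⊆ : ↑ minimals U ⊆ U
    closure⊆ j∈ with i , i∈ , i≤j ← ∈-select⁻ (above? (minimals U)) j∈ = upset i _ (proj₁ (∈-select⁻ (minimal? U) i∈)) i≤j
    ⊆closure : U ⊆ ↑ minimals U
    ⊆closure {j} j∈ with i , minimal , i≤j ← minimal-below U j j∈ = ∈-select⁺ (above? (minimals U)) (i , ∈-select⁺ (minimal? U) minimal , i≤j)

  #upsets≡#antichains : length upsets ≡ numAntichains _≤P_ isDPO
  #upsets≡#antichains = ≤-antisym
    (injective-length≤ minimals (Unique.filter⁺ isUpset? (allSubsets-unique p))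
      (λ {U} {V} U∈ V∈ same → trans (sym (↑-minimals U (upset-of U∈))) (trans (cong ↑_ same) (↑-minimals V (upset-of V∈))))
      (λ {U} _ → ∈-filter⁺ (isAntichain? _≤P_ isDPO) (allSubsets-complete _) (minimals-antichain U)))
    (injective-length≤ ↑_ (Unique.filter⁺ (isAntichain? _≤P_ isDPO) (allSubsets-unique p))
      (λ A∈ B∈ → ↑-injective (antichain-of A∈) (antichain-of B∈))
      (λ {A} _ → ∈-upsets (↑-upset A)))

  Glues : Fin p → Fin p → Subset p → Set
  Glues i j U = i ≢ j × lookup U i ≡ lookup U j

  glues? : ∀ i j U → Dec (Glues i j U)
  glues? i j U = ¬? (i ≟ᶠ j) ×-dec (lookup U i ≟ᵇ lookup U j)

  gluing : Fin p → Fin p → List (Subset p)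
  gluing i j = filter (glues? i j) upsets

  ↟ : Fin p → Subset p
  ↟ i = select (i ≤P?_)

  ↟-upset : ∀ i → IsUpset (↟ i)
  ↟-upset i j k j∈ j≤k = ∈-select⁺ (i ≤P?_) (≤P-trans (∈-select⁻ (i ≤P?_) j∈) j≤k)

  ↟-self : ∀ i → lookup (↟ i) i ≡ true
  ↟-self i = []=⇒lookup (∈-select⁺ (i ≤P?_) ≤P-refl)

  -- Some up-set does not glue i and j: if i ≰ j then ↟ i, otherwise ↟ j.
  some-upset-separates : ∀ i j → ∃ λ U → U ∈ₗ upsets × ¬ Glues i j U
  some-upset-separates i j with i ≟ᶠ j | i ≤P? j
  ... | yes i≡j | _ = ↟ i , ∈-upsets (↟-upset i) , λ glued → proj₁ glued i≡j
  ... | no _ | no i≰j = ↟ i , ∈-upsets (↟-upset i) , λ (_ , same) →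
    i≰j (∈-select⁻ (i ≤P?_) (lookup⇒[]= j _ (trans (sym same) (↟-self i))))
  ... | no i≢j | yes i≤j = ↟ j , ∈-upsets (↟-upset j) , λ (_ , same) →
    i≢j (≤P-antisym i≤j (∈-select⁻ (j ≤P?_) (lookup⇒[]= i _ (trans same (↟-self j)))))

  length-gluing : ∀ i j → length (gluing i j) ≤ pred (length upsets)
  length-gluing i j with U , U∈ , separates ← some-upset-separates i j =
    suc[m]≤n⇒m≤pred[n] (filter-notAll (glues? i j) upsets (lose U∈ separates))

  IsHom : ∀ {n} → (Fin p → Subset n) → Set
  IsHom φ = ∀ i j → i ≤P j → φ i ⊆ φ j

  hom⇒upset-columns : ∀ {n} (v : Vec (Subset n) p) → IsHom (lookup v) → ∀ x → IsUpset (lookup (columns v) x)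
  hom⇒upset-columns v hom x i j i∈ i≤j = ∈-columns⁺ v (hom i j i≤j (∈-columns⁻ v i∈))

  upset-columns⇒hom : ∀ {n} (c : Vec (Subset p) n) → (∀ x → IsUpset (lookup c x)) → IsHom (lookup (columns c))
  upset-columns⇒hom c upset i j i≤j x∈ = ∈-columns⁺ c (upset _ i j (∈-columns⁻ c x∈) i≤j)

  collision : ∀ {n} (φ : Fin p → Subset n) → IsHom φ → ¬ IsCopy _≤P_ isDPO φ →
    ∃ λ i → ∃ λ j → i ≢ j × φ i ≡ φ j
  collision φ hom notCopy with any? (λ i → any? λ j → ¬? (i ≟ᶠ j) ×-dec ≡-dec _≟ᵇ_ (φ i) (φ j))
  ... | yes found = found
  ... | no none = ⊥-elim (notCopy (hom , λ i j same → decidable-stable (i ≟ᶠ j) λ i≢j → none (i , j , i≢j , same)))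

  module _ (n : ℕ) where

    copy? : (v : Vec (Subset n) p) → Dec (IsCopy _≤P_ isDPO (lookup v))
    copy? v = isCopy? _≤P_ isDPO (lookup v)

    copies : List (Vec (Subset n) p)
    copies = filter copy? (allVecs (allSubsets n) p)

    -- Transposition embeds the copies into the n-tuples of up-sets.
    copies≤ : numCopies _≤P_ isDPO n ≤ length upsets ^ n
    copies≤ = begin
      length copies                ≤⟨ injective-length≤ columns (Unique.filter⁺ copy? (allVecs-unique _ p (allSubsets-unique n)))
                                        (λ _ _ → columns-injective) columns-upsets ⟩
      length (allVecs upsets n)    ≡⟨ length-allVecs upsets n ⟩
      length upsets ^ n            ∎
      where
      open ≤-Reasoning
      columns-upsets : ∀ {v} → v ∈ₗ copies → columns v ∈ₗ allVecs upsets n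
      columns-upsets {v} v∈ = ∈-allVecs⁺ (columns v) λ x →
        ∈-upsets (hom⇒upset-columns v (proj₁ (proj₂ (∈-filter⁻ copy? {xs = allVecs (allSubsets n) p} v∈))) x)

    gluedBy : Fin p × Fin p → List (Vec (Subset p) n)
    gluedBy (i , j) = allVecs (gluing i j) n

    glued : List (Vec (Subset p) n)
    glued = concatMap gluedBy (cartesianProduct (allFin p) (allFin p))

    length-glued : length glued ≤ p * p * pred (length upsets) ^ n
    length-glued = begin
      length glued
        ≤⟨ length-concatMap≤ gluedBy (pred (length upsets) ^ n) pairs bounded ⟩
      length pairs * pred (length upsets) ^ n
        ≡⟨ cong (_* pred (length upsets) ^ n) #pairs ⟩
      p * p * pred (length upsets) ^ n ∎
      where
      open ≤-Reasoning
      pairs = cartesianProduct (allFin p) (allFin p)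
      #pairs : length pairs ≡ p * p
      #pairs = trans (length-cartesianProductWith _,_ (allFin p) (allFin p)) (cong₂ _*_ (length-tabulate {n = p} id) (length-tabulate {n = p} id))
      bounded : ∀ {ij} → ij ∈ₗ pairs → length (gluedBy ij) ≤ pred (length upsets) ^ n
      bounded {i , j} _ = ≤-trans (≤-reflexive (length-allVecs (gluing i j) n)) (^-monoˡ-≤ n (length-gluing i j))

    copy-or-glued : ∀ {c} → c ∈ₗ allVecs upsets n → c ∈ₗ map columns copies ++ glued
    copy-or-glued {c} c∈ with copy? (columns c)
    ... | yes isCopy = ∈-++⁺ˡ (subst (_∈ₗ map columns copies) (columns-involutive c)
          (∈-map⁺ columns (∈-filter⁺ copy? (∈-allVecs⁺ (columns c) λ _ → allSubsets-complete _) isCopy)))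
    ... | no notCopy with i , j , i≢j , same ← collision (lookup (columns c)) (upset-columns⇒hom c (upset-of ∘ ∈-allVecs⁻ c c∈)) notCopy =
      ∈-++⁺ʳ (map columns copies) (∈-concatMap⁺ gluedBy (lose (∈-cartesianProduct⁺ (∈-allFin i) (∈-allFin j))
        (∈-allVecs⁺ c λ x → ∈-filter⁺ (glues? i j) (∈-allVecs⁻ c c∈ x) (i≢j , glue x))))
      where
      glue : ∀ x → lookup (lookup c x) i ≡ lookup (lookup c x) j
      glue x = trans (sym (lookup-columns c i x)) (trans (cong (λ S → lookup S x) same) (lookup-columns c j x))

    upsets^n≤ : length upsets ^ n ≤ numCopies _≤P_ isDPO n + p * p * pred (length upsets) ^ n
    upsets^n≤ = begin
      length upsets ^ n                               ≡⟨ sym (length-allVecs upsets n) ⟩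
      length (allVecs upsets n)                       ≤⟨ injective-length≤ id (allVecs-unique upsets n (Unique.filter⁺ isUpset? (allSubsets-unique p))) (λ _ _ → id) copy-or-glued ⟩
      length (map columns copies ++ glued)            ≡⟨ length-++ (map columns copies) ⟩
      length (map columns copies) + length glued      ≡⟨ cong (_+ length glued) (length-map columns copies) ⟩
      length copies + length glued                    ≤⟨ +-monoʳ-≤ (length copies) length-glued ⟩
      length copies + p * p * pred (length upsets) ^ n ∎
      where open ≤-Reasoning

theorem1 : (p : ℕ) (_≤P_ : Rel (Fin p) 0ℓ) (isDPO : IsDecPartialOrder _≡_ _≤P_)
    (m : ℕ) → numAntichains _≤P_ isDPO ≡ m →
    (k : ℕ) → ∃[ N ] (∀ n → N ≤ n →
      (suc k * numCopies _≤P_ isDPO n ≤ suc (suc k) * m ^ n)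
      × (suc k * m ^ n ≤ suc k * numCopies _≤P_ isDPO n + m ^ n))
theorem1 p _≤P_ isDPO m #antichains≡m k = suc (K * pred m) , λ n N≤n → upper n , lower n N≤n
  where
  open FinitePoset _≤P_ isDPO
  open ≤-Reasoning
  K = suc k * (p * p)
  #upsets≡m : length upsets ≡ m
  #upsets≡m = trans #upsets≡#antichains #antichains≡m
  upper : ∀ n → suc k * numCopies _≤P_ isDPO n ≤ suc (suc k) * m ^ n
  upper n = begin
    suc k * numCopies _≤P_ isDPO n  ≤⟨ *-monoʳ-≤ (suc k) (subst (λ u → _ ≤ u ^ n) #upsets≡m (copies≤ n)) ⟩
    suc k * m ^ n                   ≤⟨ *-monoˡ-≤ (m ^ n) (n≤1+n (suc k)) ⟩
    suc (suc k) * m ^ n             ∎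
  lower : ∀ n → suc (K * pred m) ≤ n → suc k * m ^ n ≤ suc k * numCopies _≤P_ isDPO n + m ^ n
  lower n large = begin
    suc k * m ^ n                        ≤⟨ *-monoʳ-≤ (suc k) (subst (λ u → u ^ n ≤ _ + p * p * pred u ^ n) #upsets≡m (upsets^n≤ n)) ⟩
    suc k * (c + p * p * ε)     ≡⟨ *-distribˡ-+ (suc k) c (p * p * ε) ⟩
    suc k * c + suc k * (p * p * ε) ≡⟨ cong (suc k * c +_) (sym (*-assoc (suc k) (p * p) ε)) ⟩
    suc k * c + K * ε           ≤⟨ +-monoʳ-≤ (suc k * c) (domination K m n large) ⟩
    suc k * c + m ^ n               ∎
    where
    c = numCopies _≤P_ isDPO n
    ε = pred m ^ n
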